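{- Let $G$ be a trivially perfect graph with cotree $T$ in which every $1$-node has at most one child that is not a leaf. Then there exists an optimal clustering $\mathcal{C}$ of $G$ such that every clade $X$ of $T$ has a single-growth in $\mathcal{C}$.
   Context: A cotree of a graph $G$ is a rooted tree $T$ whose leaf set is $V(G)$ and whose internal nodes are $0$-nodes or $1$-nodes, such that $uv\in E(G)$ iff the lowest common ancestor of $u,v$ is a $1$-node. A trivially perfect graph is a $\{P_4,C_4\}$-free graph; equivalently, one admitting a cotree in which every $1$-node has at most one non-leaf child. For $v\in V(T)$, the clade $L(v)$ is the set of leaves descending from $v$; the clades of $T$ are the sets $L(v)$, $v\in V(T)$. A clustering of $G$ is a partition of $V(G)$; its cost is the number of edges between different parts plus the number of non-adjacent pairs within a common part; an optimal clustering has minimum cost. A clade $X$ grows in a cluster $C$ if $C\cap X\ne\emptyset$ and $C\setminus X\ne\emptyset$; $X$ has a single-growth in $\mathcal{C}$ if $X$ grows in at most one cluster of $\mathcal{C}$. -}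

module Defs where

open import Data.Nat using (ℕ; _≤_; _+_)
open import Data.Bool using (Bool; true; false; _xor_; if_then_else_)
open import Data.Fin using (Fin; _<?_)
open import Data.Fin.Properties using (_≟_)
open import Data.List using (List; []; _∷_; _++_; length; lookup; map; concatMap; filter; allFin)
open import Data.Nat.ListAction using (sum)
open import Data.Unit using (⊤)
open import Data.Empty using (⊥)
open import Data.List.Membership.Propositional using (_∈_; _∉_)
open import Data.List.Relation.Unary.Unique.Propositional using (Unique)
open import Data.Product using (Σ; _×_; ∃; ∃-syntax; _,_)
open import Relation.Nullary using (¬_; ⌊_⌋)
open import Relation.Binary.PropositionalEquality using (_≡_; _≢_)
open import Function.Bundles using (_⇔_)

record Graph (n : ℕ) : Set where
  field
    adj      : Fin n → Fin n → Bool
    adj-sym  : ∀ u v → adj u v ≡ adj v u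
    adj-irr  : ∀ v → adj v v ≡ false
open Graph public

-- Rooted trees with leaves labelled by vertices; an internal node carries a
-- label (true = 1-node, false = 0-node) and a NONEMPTY list of children
-- (first child, remaining children).
data Tree (n : ℕ) : Set where
  leaf : Fin n → Tree n
  node : Bool → Tree n → List (Tree n) → Tree n

children : ∀ {n} → Tree n → List (Tree n)
children (leaf _)      = []
children (node _ c cs) = c ∷ cs

mutual
  leaves : ∀ {n} → Tree n → List (Fin n)
  leaves (leaf v)      = v ∷ []
  leaves (node _ c cs) = leaves c ++ leavesL cs

  leavesL : ∀ {n} → List (Tree n) → List (Fin n)
  leavesL []       = []
  leavesL (c ∷ cs) = leaves c ++ leavesL cs

IsLeaf : ∀ {n} → Tree n → Set
IsLeaf (leaf _)     = ⊤
IsLeaf (node _ _ _) = ⊥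

IsOneNode : ∀ {n} → Tree n → Set
IsOneNode (leaf _)     = ⊥
IsOneNode (node b _ _) = b ≡ true

data _≼_ {n : ℕ} : Tree n → Tree n → Set where
  ≼-refl  : ∀ {t} → t ≼ t
  ≼-child : ∀ {s c t} → c ∈ children t → s ≼ c → s ≼ t

LeafSetIsV : ∀ {n} → Tree n → Set
LeafSetIsV {n} T = Unique (leaves T) × (∀ (v : Fin n) → v ∈ leaves T)

IsLCA : ∀ {n} → Tree n → Tree n → Fin n → Fin n → Set
IsLCA T s u v = s ≼ T × u ∈ leaves s × v ∈ leaves s
              × (∀ c → c ∈ children s → ¬ (u ∈ leaves c × v ∈ leaves c))

IsCotree : ∀ {n} → Graph n → Tree n → Set
IsCotree {n} G T = LeafSetIsV T ×
  (∀ (u v : Fin n) → u ≢ v →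
     (adj G u v ≡ true ⇔ (∃[ s ] (IsLCA T s u v × IsOneNode s))))

OneNodesAtMostOneNonLeafChild : ∀ {n} → Tree n → Set
OneNodesAtMostOneNonLeafChild T =
  ∀ s → s ≼ T → IsOneNode s →
    ∀ (i j : Fin (length (children s))) →
      ¬ IsLeaf (lookup (children s) i) →
      ¬ IsLeaf (lookup (children s) j) → i ≡ j

-- A clustering is given by a cluster label for every vertex; its parts are
-- the nonempty label classes. n labels suffice to represent every partition.
Clustering : ℕ → Set
Clustering n = Fin n → Fin n

pairs : (n : ℕ) → List (Fin n × Fin n)
pairs n = concatMap (λ u → map (λ v → u , v) (filter (λ v → u <? v) (allFin n))) (allFin n)

cost : ∀ {n} → Graph n → Clustering n → ℕ
cost {n} G c = sum (map bad (pairs n))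
  where
    bad : Fin n × Fin n → ℕ
    bad (u , v) = if adj G u v xor ⌊ c u ≟ c v ⌋ then 1 else 0

Optimal : ∀ {n} → Graph n → Clustering n → Set
Optimal {n} G c = ∀ (c' : Clustering n) → cost G c ≤ cost G c'

Grows : ∀ {n} → Clustering n → List (Fin n) → Fin n → Set
Grows c X k = (∃[ v ] (c v ≡ k × v ∈ X)) × (∃[ v ] (c v ≡ k × v ∉ X))

SingleGrowth : ∀ {n} → Clustering n → List (Fin n) → Set
SingleGrowth {n} c X = ∀ (k k' : Fin n) → Grows c X k → Grows c X k' → k ≡ k'

-- Take an optimal clustering which, among the optimal ones, minimises the number of ordered
-- pairs of vertices sharing a cluster, and walk down the cotree.  If a child V of a clade W with a
-- single growth grew in two clusters, one of them, ka, would lie inside W.  Clades are modules, so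
-- the change of cost when a set S is moved from its cluster k to a cluster l factorises as a sum
-- over S times a sum over the vertices outside S.  Under a 0-node, splitting ka ∩ V off into a new
-- cluster lowers the cost, as V is non-adjacent to ka ∖ V.  Under a 1-node, V is the only non-leaf
-- child, so W ∖ V consists of pairwise adjacent twins, which an optimal clustering keeps together,
-- in ka.  For the other cluster kb, either splitting kb ∖ V off does not raise the cost but
-- separates pairs, or moving kb ∖ V into ka or W ∖ V into kb lowers the cost.
{-# OPTIONS --safe #-}
module Submission where

open import Defs
open import Data.Bool using (Bool; true; false; not; _∧_; _xor_; if_then_else_)
open import Data.Bool.Properties using (if-float)
open import Data.Empty using (⊥; ⊥-elim)
open import Data.Fin using (Fin; zero; suc; punchOut; _<?_)
open import Data.Fin.Properties
  using (_≟_; any?; all?; ¬∀⟶∃¬; punchOut-injective; injective⇒≤; <-cmp)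
open import Data.Integer as ℤ using (ℤ; +_; 0ℤ; 1ℤ; -1ℤ; _+_; _-_; _*_; _≤_; _<_)
import Data.Integer.Properties as ℤ
open import Algebra.Properties.Semiring.Sum ℤ.+-*-semiring
  using ( sum; sum-syntax; sum-cong-≗; sum-replicate-zero; ∑-distrib-+; ∑-comm
        ; *-distribˡ-sum; *-distribʳ-sum)
open import Data.Integer.Tactic.RingSolver using (solve-∀)
open import Data.List using (List; []; _∷_; _++_; lookup; map; concatMap; filter; tabulate; allFin)
open import Data.List.Membership.Propositional using (_∈_; _∉_)
open import Data.List.Membership.Propositional.Properties using (∈-++⁺ˡ; ∈-++⁺ʳ; ∈-++⁻)
open import Data.List.Properties using (map-++; map-∘)
open import Data.List.Relation.Binary.Disjoint.Propositional using (Disjoint)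
import Data.List.Relation.Unary.All as All
import Data.List.Relation.Unary.All.Properties as All
open import Data.List.Relation.Unary.AllPairs using ([]; _∷_)
open import Data.List.Relation.Unary.Any using (here; there; index)
open import Data.List.Relation.Unary.Any.Properties using (lookup-index)
open import Data.List.Relation.Unary.Unique.Propositional using (Unique)
open import Data.Nat as ℕ using (ℕ; zero; suc)
open import Data.Nat.ListAction using () renaming (sum to sumᴸ)
open import Data.Nat.ListAction.Properties using (sum-++)
import Data.Nat.Properties as ℕ
open import Data.Product using (∃-syntax; _×_; _,_; proj₁; proj₂)
open import Data.Sum using (_⊎_; inj₁; inj₂)
import Data.Vec.Functional as Vector
open import Function using (_∘_; id)
open import Function.Bundles using (Equivalence)
open import Level using (Level)
open import Relation.Binary using (tri<; tri≈; tri>)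
open import Relation.Binary.Bundles using (TotalOrder)
open import Relation.Binary.PropositionalEquality
open import Relation.Nullary using (Dec; ¬_; yes; no; does; contradiction; _×-dec_; ¬?)
open import Relation.Nullary.Decidable
  using (⌊_⌋; isYes≗does; dec-true; dec-false; decidable-stable; _→-dec_)
open import Relation.Unary using (Pred; Decidable; _⊆_; Empty)
open import Relation.Unary.Properties using (∁?)

private variable
  ℓ : Level
  n : ℕ
  A B : Set
  xs ys : List A
  b : Bool
  x u v z : Fin n
  d d′ s s′ t h V : Tree n
  cs hs : List (Tree n)

∑-mono-≤ : ∀ {n} {f g : Fin n → ℤ} → (∀ i → f i ≤ g i) → sum f ≤ sum g
∑-mono-≤ {zero}  f≤g = ℤ.≤-refl
∑-mono-≤ {suc n} f≤g = ℤ.+-mono-≤ (f≤g zero) (∑-mono-≤ (f≤g ∘ suc))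

∑-mono-< : ∀ {n} {f g : Fin n → ℤ} → (∀ i → f i ≤ g i) → ∀ j → f j < g j → sum f < sum g
∑-mono-< f≤g zero    fj<gj = ℤ.+-mono-<-≤ fj<gj (∑-mono-≤ (f≤g ∘ suc))
∑-mono-< f≤g (suc j) fj<gj = ℤ.+-mono-≤-< (f≤g zero) (∑-mono-< (f≤g ∘ suc) j fj<gj)

∑-neg : ∀ {n} {f : Fin n → ℤ} → (∀ i → f i ≤ 0ℤ) → ∀ j → f j < 0ℤ → sum f < 0ℤ
∑-neg {n} f≤0 j fj<0 = ℤ.<-≤-trans (∑-mono-< f≤0 j fj<0) (ℤ.≤-reflexive (sum-replicate-zero n))

∑-nonneg : ∀ {n} {f : Fin n → ℤ} → (∀ i → 0ℤ ≤ f i) → 0ℤ ≤ sum f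
∑-nonneg {n} 0≤f = ℤ.≤-trans (ℤ.≤-reflexive (sym (sum-replicate-zero n))) (∑-mono-≤ 0≤f)

∑-pos : ∀ {n} {f : Fin n → ℤ} → (∀ i → 0ℤ ≤ f i) → ∀ j → 0ℤ < f j → 0ℤ < sum f
∑-pos {n} 0≤f j 0<fj = ℤ.≤-<-trans (ℤ.≤-reflexive (sym (sum-replicate-zero n))) (∑-mono-< 0≤f j 0<fj)

∑∑ : ∀ {n} → (Fin n → Fin n → ℤ) → ℤ
∑∑ {n} f = ∑[ u < n ] ∑[ v < n ] f u v

∑∑-cong : ∀ {n} {f g : Fin n → Fin n → ℤ} → (∀ u v → f u v ≡ g u v) → ∑∑ f ≡ ∑∑ g
∑∑-cong f≡g = sum-cong-≗ λ u → sum-cong-≗ (f≡g u)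

∑∑-distrib-+ : ∀ {n} (f g : Fin n → Fin n → ℤ) → ∑∑ (λ u v → f u v + g u v) ≡ ∑∑ f + ∑∑ g
∑∑-distrib-+ f g = trans (sum-cong-≗ λ u → ∑-distrib-+ (f u) (g u)) (∑-distrib-+ (sum ∘ f) (sum ∘ g))

∑∑-product : ∀ {m n} (f : Fin m → ℤ) (g : Fin n → ℤ) →
  ∑[ i < m ] ∑[ j < n ] (f i * g j) ≡ (∑[ i < m ] f i) * (∑[ j < n ] g j)
∑∑-product f g = begin
  ∑[ i < _ ] ∑[ j < _ ] (f i * g j) ≡⟨ sum-cong-≗ (λ i → sym (*-distribˡ-sum (f i) g)) ⟩
  ∑[ i < _ ] (f i * sum g)          ≡⟨ sym (*-distribʳ-sum (sum g) f) ⟩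
  sum f * sum g                     ∎
  where open ≡-Reasoning

𝟙 : Bool → ℤ
𝟙 b = if b then 1ℤ else 0ℤ

± : Bool → ℤ
± b = if b then 1ℤ else -1ℤ

-𝟙≤0 : ∀ b → -1ℤ * 𝟙 b ≤ 0ℤ
-𝟙≤0 true  = ℤ.-≤+
-𝟙≤0 false = ℤ.≤-refl

does-≟-sym : ∀ (a b : Fin n) → does (a ≟ b) ≡ does (b ≟ a)
does-≟-sym a b with a ≟ b | b ≟ a
... | yes _   | yes _   = refl
... | no _    | no _    = refl
... | yes a≡b | no b≢a  = contradiction (sym a≡b) b≢a
... | no a≢b  | yes b≡a = contradiction (sym b≡a) a≢b

𝟙-xor-difference : ∀ a b b′ → 𝟙 (a xor b′) - 𝟙 (a xor b) ≡ ± a * (𝟙 b - 𝟙 b′)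
𝟙-xor-difference true  true  true  = refl
𝟙-xor-difference true  true  false = refl
𝟙-xor-difference true  false true  = refl
𝟙-xor-difference true  false false = refl
𝟙-xor-difference false true  true  = refl
𝟙-xor-difference false true  false = refl
𝟙-xor-difference false false true  = refl
𝟙-xor-difference false false false = refl

0≤𝟙 : ∀ b → 0ℤ ≤ 𝟙 b
0≤𝟙 true  = ℤ.+≤+ ℕ.z≤n
0≤𝟙 false = ℤ.≤-refl

𝟙-mono : (A? : Dec A) (B? : Dec B) → (A → B) → 𝟙 (does A?) ≤ 𝟙 (does B?)
𝟙-mono (no _)  B?      _   = 0≤𝟙 (does B?)
𝟙-mono (yes a) (yes _) _   = ℤ.≤-refl
𝟙-mono (yes a) (no ¬b) A→B = contradiction (A→B a) ¬b

𝟙-strict : (A? : Dec A) (B? : Dec B) → ¬ A → B → 𝟙 (does A?) < 𝟙 (does B?)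
𝟙-strict (yes a) _       ¬a _ = contradiction a ¬a
𝟙-strict (no _)  (no ¬b) _  b = contradiction b ¬b
𝟙-strict (no _)  (yes _) _  _ = ℤ.+<+ (ℕ.s≤s ℕ.z≤n)

pos*neg<0 : ∀ {i j} → 0ℤ < i → j < 0ℤ → i * j < 0ℤ
pos*neg<0 {i} 0<i j<0 =
  ℤ.<-≤-trans (ℤ.*-monoˡ-<-pos i {{ℤ.positive 0<i}} j<0) (ℤ.≤-reflexive (ℤ.*-zeroʳ i))

nonpos*nonneg≤0 : ∀ {i j} → i ≤ 0ℤ → 0ℤ ≤ j → i * j ≤ 0ℤ
nonpos*nonneg≤0 {i} {j} i≤0 0≤j =
  ℤ.≤-trans (ℤ.*-monoʳ-≤-nonNeg j {{ℤ.nonNegative 0≤j}} i≤0) (ℤ.≤-reflexive (ℤ.*-zeroˡ j))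

∑⟨_⟩ : {P : Pred (Fin n) ℓ} → Decidable P → (Fin n → ℤ) → ℤ
∑⟨ P? ⟩ f = ∑[ v < _ ] (if does (P? v) then f v else 0ℤ)

module _ {P : Pred (Fin n) ℓ} (P? : Decidable P) {f : Fin n → ℤ} where

  private
    restricted : (R : ℤ → Set) → R 0ℤ → (∀ {v} → P v → R (f v)) →
                 ∀ v → R (if does (P? v) then f v else 0ℤ)
    restricted R R0 Rf v with P? v
    ... | yes Pv = Rf Pv
    ... | no  _  = R0

    restricted-at : (R : ℤ → Set) → ∀ {y} → P y → R (f y) → R (if does (P? y) then f y else 0ℤ)
    restricted-at R {y} Py Rfy rewrite dec-true (P? y) Py = Rfy

  ∑⟨⟩-nonneg : (∀ {v} → P v → 0ℤ ≤ f v) → 0ℤ ≤ ∑⟨ P? ⟩ f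
  ∑⟨⟩-nonneg 0≤f = ∑-nonneg (restricted (0ℤ ≤_) ℤ.≤-refl 0≤f)

  ∑⟨⟩-pos : (∀ {v} → P v → 0ℤ ≤ f v) → ∀ {y} → P y → 0ℤ < f y → 0ℤ < ∑⟨ P? ⟩ f
  ∑⟨⟩-pos 0≤f Py 0<fy = ∑-pos (restricted (0ℤ ≤_) ℤ.≤-refl 0≤f) _ (restricted-at (0ℤ <_) Py 0<fy)

  ∑⟨⟩-neg : (∀ {v} → P v → f v ≤ 0ℤ) → ∀ {y} → P y → f y < 0ℤ → ∑⟨ P? ⟩ f < 0ℤ
  ∑⟨⟩-neg f≤0 Py fy<0 = ∑-neg (restricted (_≤ 0ℤ) ℤ.≤-refl f≤0) _ (restricted-at (_< 0ℤ) Py fy<0)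

count-pos : {P : Pred (Fin n) ℓ} (P? : Decidable P) {x : Fin n} → P x → 0ℤ < ∑⟨ P? ⟩ (λ _ → 1ℤ)
count-pos P? Px = ∑⟨⟩-pos P? (λ _ → ℤ.+≤+ ℕ.z≤n) Px (ℤ.+<+ (ℕ.s≤s ℕ.z≤n))

module Argmin {a ℓ₁ ℓ₂} (O : TotalOrder a ℓ₁ ℓ₂) where
  open TotalOrder O using (_≈_; total; reflexive)
    renaming (Carrier to C; _≤_ to _⊑_; refl to ⊑-refl; trans to ⊑-trans)

  argmin-Fin : ∀ {m} → Fin m → (f : Fin m → C) → ∃[ a ] ∀ b → f a ⊑ f b
  argmin-Fin {suc zero}    zero f = zero , λ { zero → ⊑-refl }
  argmin-Fin {suc (suc m)} _    f with argmin-Fin zero (f ∘ suc)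
  ... | a , fa≤ with total (f zero) (f (suc a))
  ... | inj₁ f0≤fa = zero , λ { zero → ⊑-refl ; (suc b) → ⊑-trans f0≤fa (fa≤ b) }
  ... | inj₂ fa≤f0 = suc a , λ { zero → fa≤f0 ; (suc b) → fa≤ b }

  argmin-→ : ∀ n {m} → (Fin n → Fin m) → (F : (Fin n → Fin m) → C) →
    (∀ {g h} → g ≗ h → F g ≈ F h) → ∃[ g ] ∀ h → F g ⊑ F h
  argmin-→ zero    w F F-cong = w , λ h → reflexive (F-cong λ ())
  argmin-→ (suc n) w F F-cong = best a* , λ h →
    ⊑-trans (a*≤ (Vector.head h)) (⊑-trans (best≤ (Vector.head h) (Vector.tail h))
                                            (reflexive (F-cong λ { zero → refl ; (suc i) → refl })))
    where
    best-tail : ∀ a → ∃[ g ] ∀ h → F (a Vector.∷ g) ⊑ F (a Vector.∷ h)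
    best-tail a = argmin-→ n (Vector.tail w) (λ g → F (a Vector.∷ g))
                          (λ g≗h → F-cong λ { zero → refl ; (suc i) → g≗h i })
    best : Fin _ → Fin (suc n) → Fin _
    best a = a Vector.∷ proj₁ (best-tail a)
    best≤ : ∀ a h → F (best a) ⊑ F (a Vector.∷ h)
    best≤ a = proj₂ (best-tail a)
    a* = proj₁ (argmin-Fin (Vector.head w) (F ∘ best))
    a*≤ = proj₂ (argmin-Fin (Vector.head w) (F ∘ best))

unused-label : ∀ {n} (c : Fin n → Fin n) {u v} → u ≢ v → c u ≡ c v → ∃[ l ] ∀ w → c w ≢ l
unused-label {zero}  c {()}
unused-label {suc n} c {u} {v} u≢v cu≡cv with any? (λ l → all? (λ w → ¬? (c w ≟ l)))
... | yes unused = unused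
... | no  all-used = ⊥-elim (ℕ.n≮n _ (injective⇒≤ {f = λ l → punchOut (avoids-v l)} g-injective))
  where
  -- If every label is used, c has a section g that avoids v (u stands in for it, as c u ≡ c v);
  -- punching v out of g then injects Fin (suc n) into Fin n.
  preimage : ∀ l → ∃[ w ] c w ≡ l
  preimage l with ¬∀⟶∃¬ (suc n) _ (λ w → ¬? (c w ≟ l)) (λ none → all-used (l , none))
  ... | w , hit with c w ≟ l
  ...   | yes cw≡l = w , cw≡l
  ...   | no  cw≢l = ⊥-elim (hit cw≢l)
  g : Fin (suc n) → Fin (suc n)
  g l with preimage l
  ... | w , _ with w ≟ v
  ...   | yes _ = u
  ...   | no  _ = w
  c∘g : ∀ l → c (g l) ≡ l
  c∘g l with preimage l
  ... | w , cw≡l with w ≟ v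
  ...   | yes refl = trans cu≡cv cw≡l
  ...   | no  _    = cw≡l
  avoids-v : ∀ l → v ≢ g l
  avoids-v l with preimage l
  ... | w , _ with w ≟ v
  ...   | yes _   = u≢v ∘ sym
  ...   | no  w≢v = w≢v ∘ sym
  g-injective : ∀ {a b} → punchOut (avoids-v a) ≡ punchOut (avoids-v b) → a ≡ b
  g-injective {a} {b} eq =
    trans (sym (c∘g a)) (trans (cong c (punchOut-injective (avoids-v a) (avoids-v b) eq)) (c∘g b))

Unique-++⁻ : ∀ xs → Unique (xs ++ ys) → Unique xs × Unique ys × Disjoint xs ys
Unique-++⁻ []       u          = [] , u , λ ()
Unique-++⁻ (x ∷ xs) (x∉ ∷ u) with Unique-++⁻ xs u
... | uxs , uys , disj = All.++⁻ˡ xs x∉ ∷ uxs , uys , λ where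
  (here refl , y∈ys) → All.lookup x∉ (∈-++⁺ʳ xs y∈ys) refl
  (there y∈xs , y∈ys) → disj (y∈xs , y∈ys)

∈∉⇒≢ : x ∈ xs → z ∉ xs → x ≢ z
∈∉⇒≢ x∈ z∉ refl = z∉ x∈

∈-leavesL⁺ : d ∈ cs → x ∈ leaves d → x ∈ leavesL cs
∈-leavesL⁺ (here refl) x∈d = ∈-++⁺ˡ x∈d
∈-leavesL⁺ {cs = e ∷ _} (there d∈cs) x∈d = ∈-++⁺ʳ (leaves e) (∈-leavesL⁺ d∈cs x∈d)

∈-leavesL⁻ : x ∈ leavesL cs → ∃[ d ] d ∈ cs × x ∈ leaves d
∈-leavesL⁻ {cs = e ∷ ds} x∈ with ∈-++⁻ (leaves e) x∈
... | inj₁ x∈e = e , here refl , x∈e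
... | inj₂ x∈ds with ∈-leavesL⁻ x∈ds
...   | d , d∈ds , x∈d = d , there d∈ds , x∈d

Unique-leavesL⁻ : Unique (leavesL cs) → d ∈ cs → Unique (leaves d)
Unique-leavesL⁻ {cs = e ∷ _} u (here refl)  = proj₁ (Unique-++⁻ (leaves e) u)
Unique-leavesL⁻ {cs = e ∷ _} u (there d∈cs) =
  Unique-leavesL⁻ (proj₁ (proj₂ (Unique-++⁻ (leaves e) u))) d∈cs

leavesL-disjoint : Unique (leavesL cs) → d ∈ cs → d′ ∈ cs →
  x ∈ leaves d → x ∈ leaves d′ → d ≡ d′
leavesL-disjoint {cs = e ∷ _} u (here refl) (here refl) _ _ = refl
leavesL-disjoint {cs = e ∷ _} u (here refl) (there d′∈) x∈d x∈d′ =
  ⊥-elim (proj₂ (proj₂ (Unique-++⁻ (leaves e) u)) (x∈d , ∈-leavesL⁺ d′∈ x∈d′))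
leavesL-disjoint {cs = e ∷ _} u (there d∈) (here refl) x∈d x∈d′ =
  ⊥-elim (proj₂ (proj₂ (Unique-++⁻ (leaves e) u)) (x∈d′ , ∈-leavesL⁺ d∈ x∈d))
leavesL-disjoint {cs = e ∷ _} u (there d∈) (there d′∈) =
  leavesL-disjoint (proj₁ (proj₂ (Unique-++⁻ (leaves e) u))) d∈ d′∈

leaves-child : d ∈ children t → x ∈ leaves d → x ∈ leaves t
leaves-child {t = node _ h hs} = ∈-leavesL⁺ {cs = h ∷ hs}

leaves-≼ : s ≼ t → x ∈ leaves s → x ∈ leaves t
leaves-≼ ≼-refl            = λ x∈s → x∈s
leaves-≼ (≼-child d∈ s≼d) = leaves-child d∈ ∘ leaves-≼ s≼d

≼-trans : ∀ {r} → s ≼ t → t ≼ r → s ≼ r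
≼-trans s≼t ≼-refl             = s≼t
≼-trans s≼t (≼-child t′∈ t≼t′) = ≼-child t′∈ (≼-trans s≼t t≼t′)

Unique-child : Unique (leaves t) → d ∈ children t → Unique (leaves d)
Unique-child {t = node _ h hs} = Unique-leavesL⁻ {cs = h ∷ hs}

Unique-≼ : Unique (leaves t) → s ≼ t → Unique (leaves s)
Unique-≼ u ≼-refl             = u
Unique-≼ u (≼-child d∈ s≼d) = Unique-≼ (Unique-child u d∈) s≼d

children-disjoint : Unique (leaves t) → d ∈ children t → d′ ∈ children t →
  x ∈ leaves d → x ∈ leaves d′ → d ≡ d′
children-disjoint {t = node _ h hs} = leavesL-disjoint {cs = h ∷ hs}

≼-comparable : Unique (leaves t) → s ≼ t → s′ ≼ t → x ∈ leaves s → x ∈ leaves s′ →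
  s ≼ s′ ⊎ s′ ≼ s
≼-comparable u ≼-refl              s′≼t  _   _    = inj₂ s′≼t
≼-comparable u (≼-child d∈ s≼d)  ≼-refl _   _    = inj₁ (≼-child d∈ s≼d)
≼-comparable u (≼-child d∈ s≼d) (≼-child d′∈ s′≼d′) x∈s x∈s′
  with children-disjoint u d∈ d′∈ (leaves-≼ s≼d x∈s) (leaves-≼ s′≼d′ x∈s′)
... | refl = ≼-comparable (Unique-child u d∈) s≼d s′≼d′ x∈s x∈s′

lca-unique : ∀ {T : Tree n} → Unique (leaves T) → IsLCA T s u v → IsLCA T s′ u v → s ≡ s′
lca-unique uT (s≼T , u∈s , v∈s , s-lowest) (s′≼T , u∈s′ , v∈s′ , s′-lowest)
  with ≼-comparable uT s≼T s′≼T u∈s u∈s′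
... | inj₁ ≼-refl = refl
... | inj₁ (≼-child d∈ s≼d) = ⊥-elim (s′-lowest _ d∈ (leaves-≼ s≼d u∈s , leaves-≼ s≼d v∈s))
... | inj₂ ≼-refl = refl
... | inj₂ (≼-child d∈ s′≼d) =
  ⊥-elim (s-lowest _ d∈ (leaves-≼ s′≼d u∈s′ , leaves-≼ s′≼d v∈s′))

module Cotree {G : Graph n} {T : Tree n} (cot : IsCotree G T) where

  unique-leaves : Unique (leaves T)
  unique-leaves = proj₁ (proj₁ cot)

  every-vertex-leaf : ∀ v → v ∈ leaves T
  every-vertex-leaf = proj₂ (proj₁ cot)

  private
    edge⇔lca-one : u ≢ v → adj G u v ≡ true → ∃[ s ] IsLCA T s u v × IsOneNode s
    edge⇔lca-one u≢v = Equivalence.to (proj₂ cot _ _ u≢v)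

  lca-one⇒edge : u ≢ v → IsLCA T s u v → IsOneNode s → adj G u v ≡ true
  lca-one⇒edge u≢v lca one = Equivalence.from (proj₂ cot _ _ u≢v) (_ , lca , one)

  lca-across-child : ∀ {W} → W ≼ T → V ∈ children W →
    u ∈ leaves V → z ∈ leaves W → z ∉ leaves V → IsLCA T W u z
  lca-across-child W≼T V∈ u∈V z∈W z∉V = W≼T , leaves-child V∈ u∈V , z∈W , λ where
    d d∈ (u∈d , z∈d) →
      z∉V (subst (λ d → _ ∈ leaves d)
                 (children-disjoint (Unique-≼ unique-leaves W≼T) d∈ V∈ u∈d u∈V) z∈d)

  adj-across-child : node b h hs ≼ T → V ∈ children (node b h hs) → u ∈ leaves V →
    z ∈ leaves (node b h hs) → z ∉ leaves V → adj G u z ≡ b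
  adj-across-child {b = true} W≼T V∈ u∈V z∈W z∉V =
    lca-one⇒edge (∈∉⇒≢ u∈V z∉V) (lca-across-child W≼T V∈ u∈V z∈W z∉V) refl
  adj-across-child {b = false} {u = u} {z = z} W≼T V∈ u∈V z∈W z∉V with adj G u z in uz
  ... | false = refl
  ... | true with edge⇔lca-one (∈∉⇒≢ u∈V z∉V) uz
  ...   | s , lca , one with lca-unique unique-leaves lca (lca-across-child W≼T V∈ u∈V z∈W z∉V)
  ...     | refl with one
  ...       | ()

  private
    module-edge : ∀ {W} → W ≼ T → u ∉ leaves W → v ∈ leaves W → z ∈ leaves W →
      adj G u v ≡ true → adj G u z ≡ true
    module-edge {u = u} {z = z} W≼T u∉W v∈W z∈W uv with edge⇔lca-one (λ { refl → u∉W v∈W }) uv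
    ... | s , (s≼T , u∈s , v∈s , s-lowest) , one with ≼-comparable unique-leaves s≼T W≼T v∈s v∈W
    ...   | inj₁ s≼W = ⊥-elim (u∉W (leaves-≼ s≼W u∈s))
    ...   | inj₂ ≼-refl = ⊥-elim (u∉W u∈s)
    ...   | inj₂ (≼-child {c = d} d∈ W≼d) =
      lca-one⇒edge (λ { refl → u∉W z∈W })
                   (s≼T , u∈s , leaves-child d∈ (leaves-≼ W≼d z∈W) , z-lowest) one
      where
      z-lowest : ∀ e → e ∈ children s → ¬ (u ∈ leaves e × z ∈ leaves e)
      z-lowest e e∈ (u∈e , z∈e)
        with children-disjoint (Unique-≼ unique-leaves s≼T) d∈ e∈ (leaves-≼ W≼d z∈W) z∈e
      ... | refl = s-lowest d d∈ (u∈e , leaves-≼ W≼d v∈W)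

  clade-module : ∀ {W} → W ≼ T → u ∉ leaves W → v ∈ leaves W → z ∈ leaves W →
    adj G u v ≡ adj G u z
  clade-module {u = u} {v = v} {z = z} W≼T u∉W v∈W z∈W with adj G u v in uv | adj G u z in uz
  ... | false | false = refl
  ... | true  | true  = refl
  ... | true  | false = trans (sym (module-edge W≼T u∉W v∈W z∈W uv)) uz
  ... | false | true  = trans (sym uv) (module-edge W≼T u∉W z∈W v∈W uz)

  other-children-are-leaves : OneNodesAtMostOneNonLeafChild T →
    node true h hs ≼ T → V ∈ children (node true h hs) → ¬ IsLeaf V →
    z ∈ leaves (node true h hs) → z ∉ leaves V → leaf z ∈ children (node true h hs)
  other-children-are-leaves {h = h} {hs = hs} {V = V} one W≼T V∈ V-inner z∈W z∉V
    with ∈-leavesL⁻ {cs = h ∷ hs} z∈W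
  ... | leaf _ , d∈ , here refl = d∈
  ... | node b e es , d∈ , z∈d = ⊥-elim (z∉V (subst (λ t → _ ∈ leaves t) d≡V z∈d))
    where
    same-index : index d∈ ≡ index V∈
    same-index = one _ W≼T refl (index d∈) (index V∈)
      (subst (λ t → ¬ IsLeaf t) (lookup-index d∈) (λ ()))
      (subst (λ t → ¬ IsLeaf t) (lookup-index V∈) V-inner)
    d≡V : node b e es ≡ V
    d≡V = trans (lookup-index d∈) (trans (cong (lookup (h ∷ hs)) same-index) (sym (lookup-index V∈)))

-- The cost as a sum over pairs

upper : (Fin n → Fin n → ℤ) → Fin n → Fin n → ℤ
upper f u v = if does (u <? v) then f u v else 0ℤ

across : {P : Pred (Fin n) ℓ} → Decidable P → (Fin n → Fin n → ℤ) → Fin n → Fin n → ℤ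
across P? f u v = if does (P? u) ∧ not (does (P? v)) then f u v else 0ℤ

∑-pairs : (Fin n → Fin n → ℤ) → ℤ
∑-pairs f = ∑∑ (upper f)

∑-across : {P : Pred (Fin n) ℓ} → Decidable P → (Fin n → Fin n → ℤ) → ℤ
∑-across P? f = ∑∑ (across P? f)

∑-pairs-cong : {f g : Fin n → Fin n → ℤ} → (∀ u v → f u v ≡ g u v) → ∑-pairs f ≡ ∑-pairs g
∑-pairs-cong f≡g = ∑∑-cong λ u v → cong (λ x → if does (u <? v) then x else 0ℤ) (f≡g u v)

∑-pairs-distrib-+ : (f g : Fin n → Fin n → ℤ) →
  ∑-pairs (λ u v → f u v + g u v) ≡ ∑-pairs f + ∑-pairs g
∑-pairs-distrib-+ f g =
  trans (∑∑-cong λ u v → if-distrib (does (u <? v)) {f u v} {g u v}) (∑∑-distrib-+ (upper f) (upper g))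
  where
  if-distrib : ∀ b {x y} → (if b then x + y else 0ℤ) ≡ (if b then x else 0ℤ) + (if b then y else 0ℤ)
  if-distrib true  = refl
  if-distrib false = refl

∑-across-cong : {P : Pred (Fin n) ℓ} (P? : Decidable P) {f g : Fin n → Fin n → ℤ} →
  (∀ {u v} → P u → ¬ P v → f u v ≡ g u v) → ∑-across P? f ≡ ∑-across P? g
∑-across-cong P? {f} {g} f≡g = ∑∑-cong pointwise
  where
  pointwise : ∀ u v → across P? f u v ≡ across P? g u v
  pointwise u v with P? u | P? v
  ... | yes Pu | no ¬Pv = f≡g Pu ¬Pv
  ... | yes _  | yes _  = refl
  ... | no _   | _      = refl

∑-pairs≡∑-across : {P : Pred (Fin n) ℓ} (P? : Decidable P) (D : Fin n → Fin n → ℤ) →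
  (∀ u v → D u v ≡ D v u) →
  (∀ {u v} → P u → P v → D u v ≡ 0ℤ) → (∀ {u v} → ¬ P u → ¬ P v → D u v ≡ 0ℤ) →
  ∑-pairs D ≡ ∑-across P? D
∑-pairs≡∑-across P? D D-sym inside outside = begin
  ∑-pairs D                                ≡⟨ ∑-pairs-cong split ⟩
  ∑-pairs (λ u v → E u v + Eᵀ u v)         ≡⟨ ∑-pairs-distrib-+ E Eᵀ ⟩
  ∑∑ (upper E) + ∑∑ (upper Eᵀ)             ≡⟨ cong (_+_ (∑∑ (upper E))) (∑-comm (upper Eᵀ)) ⟩
  ∑∑ (upper E) + ∑∑ (λ u v → upper Eᵀ v u) ≡⟨ sym (∑∑-distrib-+ (upper E) _) ⟩
  ∑∑ (λ u v → upper E u v + upper Eᵀ v u)  ≡⟨ ∑∑-cong merge ⟩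
  ∑-across P? D                            ∎
  where
  open ≡-Reasoning
  E : _ → _ → ℤ
  E = across P? D
  Eᵀ : _ → _ → ℤ
  Eᵀ u v = E v u
  split : ∀ u v → D u v ≡ E u v + Eᵀ u v
  split u v with P? u | P? v
  ... | yes Pu  | yes Pv  = inside Pu Pv
  ... | yes _   | no _    = sym (ℤ.+-identityʳ _)
  ... | no _    | yes _   = trans (D-sym u v) (sym (ℤ.+-identityˡ _))
  ... | no ¬Pu  | no ¬Pv  = outside ¬Pu ¬Pv
  merge : ∀ u v → upper E u v + upper Eᵀ v u ≡ E u v
  merge u v with <-cmp u v
  ... | tri< u<v _ v≮u rewrite dec-true (u <? v) u<v | dec-false (v <? u) v≮u = ℤ.+-identityʳ _
  ... | tri> u≮v _ v<u rewrite dec-false (u <? v) u≮v | dec-true (v <? u) v<u = ℤ.+-identityˡ _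
  ... | tri≈ u≮v refl _ rewrite dec-false (u <? u) u≮v with P? u
  ...   | yes _ = refl
  ...   | no _  = refl

+-sum-map-tabulate : ∀ {m} (f : A → ℕ) (g : Fin m → A) →
  + sumᴸ (map f (tabulate g)) ≡ ∑[ i < m ] (+ f (g i))
+-sum-map-tabulate {m = zero}  f g = refl
+-sum-map-tabulate {m = suc m} f g =
  trans (ℤ.pos-+ (f (g zero)) _) (cong (_+_ (+ f (g zero))) (+-sum-map-tabulate f (g ∘ suc)))

sum-map-filter : ∀ {P : Pred A ℓ} (P? : Decidable P) (f : A → ℕ) xs →
  sumᴸ (map f (filter P? xs)) ≡ sumᴸ (map (λ x → if does (P? x) then f x else 0) xs)
sum-map-filter P? f []       = refl
sum-map-filter P? f (x ∷ xs) with does (P? x)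
... | true  = cong (f x ℕ.+_) (sum-map-filter P? f xs)
... | false = sum-map-filter P? f xs

sum-map-concatMap : (f : B → ℕ) (g : A → List B) → ∀ xs →
  sumᴸ (map f (concatMap g xs)) ≡ sumᴸ (map (sumᴸ ∘ map f ∘ g) xs)
sum-map-concatMap f g []       = refl
sum-map-concatMap f g (x ∷ xs) = begin
  sumᴸ (map f (g x ++ concatMap g xs))                     ≡⟨ cong sumᴸ (map-++ f (g x) _) ⟩
  sumᴸ (map f (g x) ++ map f (concatMap g xs))             ≡⟨ sum-++ (map f (g x)) _ ⟩
  sumᴸ (map f (g x)) ℕ.+ sumᴸ (map f (concatMap g xs))     ≡⟨ cong (sumᴸ (map f (g x)) ℕ.+_)
                                                                   (sum-map-concatMap f g xs) ⟩
  sumᴸ (map f (g x)) ℕ.+ sumᴸ (map (sumᴸ ∘ map f ∘ g) xs) ∎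
  where open ≡-Reasoning

+-sum-pairs : (f : Fin n × Fin n → ℕ) → + sumᴸ (map f (pairs n)) ≡ ∑-pairs (λ u v → + f (u , v))
+-sum-pairs {n} f = begin
  + sumᴸ (map f (pairs n))                     ≡⟨ cong +_ (sum-map-concatMap f row (allFin n)) ⟩
  + sumᴸ (map (sumᴸ ∘ map f ∘ row) (allFin n)) ≡⟨ +-sum-map-tabulate (sumᴸ ∘ map f ∘ row) id ⟩
  ∑[ u < n ] (+ sumᴸ (map f (row u)))          ≡⟨ sum-cong-≗ row-sum ⟩
  ∑-pairs (λ u v → + f (u , v))                ∎
  where
  open ≡-Reasoning
  row : Fin n → List (Fin n × Fin n)
  row u = map (u ,_) (filter (u <?_) (allFin n))
  above : Fin n → Fin n → ℕ
  above u v = if does (u <? v) then f (u , v) else 0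
  row-sum : ∀ u → + sumᴸ (map f (row u)) ≡ ∑[ v < n ] upper (λ u v → + f (u , v)) u v
  row-sum u = begin
    + sumᴸ (map f (row u))
      ≡⟨ cong (+_ ∘ sumᴸ) (sym (map-∘ (filter (u <?_) (allFin n)))) ⟩
    + sumᴸ (map (f ∘ (u ,_)) (filter (u <?_) (allFin n)))
      ≡⟨ cong +_ (sum-map-filter (u <?_) (f ∘ (u ,_)) (allFin n)) ⟩
    + sumᴸ (map (above u) (allFin n))
      ≡⟨ +-sum-map-tabulate (above u) id ⟩
    ∑[ v < n ] (+ above u v)
      ≡⟨ sum-cong-≗ (λ v → if-float +_ (does (u <? v)) {f (u , v)} {0}) ⟩
    ∑[ v < n ] upper (λ u v → + f (u , v)) u v
      ∎

module _ {n} (G : Graph n) where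

  disagree : Fin n → Fin n → Fin n → Fin n → ℤ
  disagree u v a b = 𝟙 (adj G u v xor does (a ≟ b))

  disagreement : Clustering n → Fin n → Fin n → ℤ
  disagreement c u v = disagree u v (c u) (c v)

  disagree-sym : ∀ u v a b → disagree u v a b ≡ disagree v u b a
  disagree-sym u v a b = cong₂ (λ e s → 𝟙 (e xor s)) (adj-sym G u v) (does-≟-sym a b)

  disagree-equal : ∀ {u v a b a′ b′} → a ≡ b → a′ ≡ b′ → disagree u v a b ≡ disagree u v a′ b′
  disagree-equal {a = a} {b} {a′} {b′} a≡b a′≡b′
    rewrite dec-true (a ≟ b) a≡b | dec-true (a′ ≟ b′) a′≡b′ = refl

  cost-as-∑-pairs : ∀ c → + cost G c ≡ ∑-pairs (disagreement c)
  cost-as-∑-pairs c = trans (+-sum-pairs bad) (∑-pairs-cong λ u v →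
    trans (if-float +_ (adj G u v xor ⌊ c u ≟ c v ⌋))
          (cong (λ b → 𝟙 (adj G u v xor b)) (isYes≗does (c u ≟ c v))))
    where
    bad : Fin n × Fin n → ℕ
    bad (u , v) = if adj G u v xor ⌊ c u ≟ c v ⌋ then 1 else 0

cost-cong : ∀ (G : Graph n) {c c′} → (∀ v → c v ≡ c′ v) → cost G c ≡ cost G c′
cost-cong G {c} {c′} c≗c′ = ℤ.+-injective (begin
  + cost G c                 ≡⟨ cost-as-∑-pairs G c ⟩
  ∑-pairs (disagreement G c)  ≡⟨ ∑-pairs-cong (λ u v → cong₂ (disagree G u v) (c≗c′ u) (c≗c′ v)) ⟩
  ∑-pairs (disagreement G c′) ≡⟨ sym (cost-as-∑-pairs G c′) ⟩
  + cost G c′                ∎)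
  where open ≡-Reasoning

-- Moving a set of vertices to another cluster

relabel : {P : Pred (Fin n) ℓ} → Decidable P → Fin n → Clustering n → Clustering n
relabel P? l c v = if does (P? v) then l else c v

together : Clustering n → ℤ
together c = ∑∑ λ u v → 𝟙 (does (c u ≟ c v))

together-cong : ∀ {c c′ : Clustering n} → (∀ v → c v ≡ c′ v) → together c ≡ together c′
together-cong c≗c′ = ∑∑-cong λ u v → cong₂ (λ a b → 𝟙 (does (a ≟ b))) (c≗c′ u) (c≗c′ v)

module Relabelling {n} (G : Graph n) (c : Clustering n) where

  cluster : Fin n → Pred (Fin n) _
  cluster k v = c v ≡ k

  σ : Fin n → Fin n → ℤ
  σ u v = ± (adj G u v)

  δ : Fin n → Fin n → Fin n → ℤ
  δ k l v = 𝟙 (does (c v ≟ k)) - 𝟙 (does (c v ≟ l))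

  δ-unused : ∀ {k l} → Empty (cluster l) → ∀ v → δ k l v ≡ 𝟙 (does (c v ≟ k))
  δ-unused {k} {l} l-unused v rewrite dec-false (c v ≟ l) (l-unused v) = ℤ.+-identityʳ _

  gain : {P : Pred (Fin n) ℓ} → Decidable P → Fin n → Fin n → ℤ
  gain P? k l = ∑-across P? λ u v → σ u v * δ k l v

  module _ {P : Pred (Fin n) ℓ} (P? : Decidable P) (l : Fin n) where

    relabel-in : ∀ {u} → P u → relabel P? l c u ≡ l
    relabel-in {u} Pu rewrite dec-true (P? u) Pu = refl

    relabel-out : ∀ {u} → ¬ P u → relabel P? l c u ≡ c u
    relabel-out {u} ¬Pu rewrite dec-false (P? u) ¬Pu = refl

    cost-relabel : ∀ {k} → P ⊆ cluster k → + cost G (relabel P? l c) ≡ + cost G c + gain P? k l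
    cost-relabel {k} P⊆k = begin
      + cost G c′
        ≡⟨ cost-as-∑-pairs G c′ ⟩
      ∑-pairs (disagreement G c′)
        ≡⟨ ∑-pairs-cong (λ u v → x≡y+[x-y] _ (disagreement G c u v)) ⟩
      ∑-pairs (λ u v → disagreement G c u v + D u v)
        ≡⟨ ∑-pairs-distrib-+ (disagreement G c) D ⟩
      ∑-pairs (disagreement G c) + ∑-pairs D
        ≡⟨ cong₂ _+_ (sym (cost-as-∑-pairs G c)) (∑-pairs≡∑-across P? D D-sym inside outside) ⟩
      + cost G c + ∑-across P? D
        ≡⟨ cong (_+_ (+ cost G c)) (∑-across-cong P? across-P) ⟩
      + cost G c + gain P? k l
        ∎
      where
      open ≡-Reasoning
      c′ = relabel P? l c
      D : Fin n → Fin n → ℤ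
      D u v = disagreement G c′ u v - disagreement G c u v
      x≡y+[x-y] : ∀ x y → x ≡ y + (x - y)
      x≡y+[x-y] = solve-∀
      D-sym : ∀ u v → D u v ≡ D v u
      D-sym u v = cong₂ _-_ (disagree-sym G u v (c′ u) (c′ v)) (disagree-sym G u v (c u) (c v))
      inside : ∀ {u v} → P u → P v → D u v ≡ 0ℤ
      inside {u} {v} Pu Pv =
        trans (cong (_- _) (disagree-equal G (trans (relabel-in Pu) (sym (relabel-in Pv)))
                                             (trans (P⊆k Pu) (sym (P⊆k Pv)))))
              (ℤ.+-inverseʳ (disagreement G c u v))
      outside : ∀ {u v} → ¬ P u → ¬ P v → D u v ≡ 0ℤ
      outside {u} {v} ¬Pu ¬Pv =
        trans (cong (_- _) (cong₂ (disagree G u v) (relabel-out ¬Pu) (relabel-out ¬Pv)))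
              (ℤ.+-inverseʳ (disagreement G c u v))
      across-P : ∀ {u v} → P u → ¬ P v → D u v ≡ σ u v * δ k l v
      across-P {u} {v} Pu ¬Pv = begin
        D u v
          ≡⟨ cong₂ _-_ (cong₂ (disagree G u v) (relabel-in Pu) (relabel-out ¬Pv))
                       (cong (λ a → disagree G u v a (c v)) (P⊆k Pu)) ⟩
        disagree G u v l (c v) - disagree G u v k (c v)
          ≡⟨ 𝟙-xor-difference (adj G u v) _ _ ⟩
        σ u v * (𝟙 (does (k ≟ c v)) - 𝟙 (does (l ≟ c v)))
          ≡⟨ cong₂ (λ x y → σ u v * (𝟙 x - 𝟙 y)) (does-≟-sym k (c v)) (does-≟-sym l (c v)) ⟩
        σ u v * δ k l v
          ∎

  marginal : {P : Pred (Fin n) ℓ} → Decidable P → Fin n → Fin n → (Fin n → ℤ) → ℤ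
  marginal P? k l τ = ∑⟨ ∁? P? ⟩ λ v → τ v * δ k l v

  SignsFactorise : Pred (Fin n) ℓ → Fin n → Fin n → (Fin n → ℤ) → (Fin n → ℤ) → Set ℓ
  SignsFactorise P k l ρ τ = ∀ {u v} → P u → ¬ P v → c v ≡ k ⊎ c v ≡ l → σ u v ≡ ρ u * τ v

  gain-factorises : {P : Pred (Fin n) ℓ} (P? : Decidable P) {k l : Fin n} {ρ τ : Fin n → ℤ} →
    SignsFactorise P k l ρ τ → gain P? k l ≡ ∑⟨ P? ⟩ ρ * marginal P? k l τ
  gain-factorises {P = P} P? {k} {l} {ρ} {τ} σ≡ρτ = trans (∑∑-cong pointwise) (∑∑-product inner outer)
    where
    inner outer : Fin n → ℤ
    inner u = if does (P? u) then ρ u else 0ℤ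
    outer v = if does (∁? P? v) then τ v * δ k l v else 0ℤ
    unaffected : ∀ {v} → c v ≢ k → c v ≢ l → δ k l v ≡ 0ℤ
    unaffected {v} ≢k ≢l rewrite dec-false (c v ≟ k) ≢k | dec-false (c v ≟ l) ≢l = refl
    affected-or-zero : ∀ v → (c v ≡ k ⊎ c v ≡ l) ⊎ δ k l v ≡ 0ℤ
    affected-or-zero v = classify (c v ≟ k) (c v ≟ l)
      where
      classify : Dec (c v ≡ k) → Dec (c v ≡ l) → (c v ≡ k ⊎ c v ≡ l) ⊎ δ k l v ≡ 0ℤ
      classify (yes ≡k) _        = inj₁ (inj₁ ≡k)
      classify (no _)   (yes ≡l) = inj₁ (inj₂ ≡l)
      classify (no ≢k)  (no ≢l)  = inj₂ (unaffected ≢k ≢l)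
    crossing : ∀ {u v} → P u → ¬ P v → σ u v * δ k l v ≡ ρ u * (τ v * δ k l v)
    crossing {u} {v} Pu ¬Pv with affected-or-zero v
    ... | inj₁ kl  = trans (cong (_* δ k l v) (σ≡ρτ Pu ¬Pv kl)) (ℤ.*-assoc (ρ u) (τ v) _)
    ... | inj₂ δ≡0 rewrite δ≡0 =
      trans (ℤ.*-zeroʳ (σ u v)) (sym (trans (cong (ρ u *_) (ℤ.*-zeroʳ (τ v))) (ℤ.*-zeroʳ (ρ u))))
    pointwise : ∀ u v → across P? (λ u v → σ u v * δ k l v) u v ≡ inner u * outer v
    pointwise u v with P? u | P? v
    ... | yes Pu | no ¬Pv = crossing Pu ¬Pv
    ... | yes _  | yes _  = sym (ℤ.*-zeroʳ (ρ u))
    ... | no _   | _      = refl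

  together-split : {P : Pred (Fin n) ℓ} (P? : Decidable P) {k l x y : Fin n} →
    P ⊆ cluster k → Empty (cluster l) → c x ≡ k → ¬ P x → P y → together (relabel P? l c) < together c
  together-split {P = P} P? {k} {l} {x} {y} P⊆k l-unused cx≡k ¬Px Py =
    ∑-mono-< (λ u → ∑-mono-≤ (pair≤ u)) x
             (∑-mono-< (pair≤ x) y
                       (𝟙-strict (c′ x ≟ c′ y) (c x ≟ c y) separated (trans cx≡k (sym (P⊆k Py)))))
    where
    c′ = relabel P? l c
    still-together : ∀ u v → c′ u ≡ c′ v → c u ≡ c v
    still-together u v c′u≡c′v with P? u | P? v
    ... | yes Pu  | yes Pv  = trans (P⊆k Pu) (sym (P⊆k Pv))
    ... | yes _   | no _    = ⊥-elim (l-unused v (sym c′u≡c′v))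
    ... | no _    | yes _   = ⊥-elim (l-unused u c′u≡c′v)
    ... | no _    | no _    = c′u≡c′v
    pair≤ : ∀ u v → 𝟙 (does (c′ u ≟ c′ v)) ≤ 𝟙 (does (c u ≟ c v))
    pair≤ u v = 𝟙-mono (c′ u ≟ c′ v) (c u ≟ c v) (still-together u v)
    separated : c′ x ≢ c′ y
    separated c′x≡c′y =
      l-unused x (trans (sym (relabel-out P? l ¬Px)) (trans c′x≡c′y (relabel-in P? l Py)))

-- Optimal clusterings with the fewest pairs together

IsFinest : Graph n → Clustering n → Set
IsFinest G c = ∀ c′ → cost G c′ ℕ.≤ cost G c → together c ≤ together c′

-- Lexicographic minimisation of (cost, together): the second stage minimises together over all
-- clusterings, with non-optimal ones pushed above the value reached by an optimal one.
optimal-finest-clustering : ∀ (G : Graph n) → ∃[ c ] Optimal G c × IsFinest G c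
optimal-finest-clustering {n} G = c₁ , c₁-optimal , c₁-finest
  where
  open Argmin
  c₀ = proj₁ (argmin-→ ℕ.≤-totalOrder n id (cost G) (cost-cong G))
  c₀-optimal : Optimal G c₀
  c₀-optimal = proj₂ (argmin-→ ℕ.≤-totalOrder n id (cost G) (cost-cong G))
  penalised : Clustering n → ℤ
  penalised c = if does (cost G c ℕ.≤? cost G c₀) then together c else ℤ.suc (together c₀)
  penalised-cong : ∀ {c c′} → (∀ v → c v ≡ c′ v) → penalised c ≡ penalised c′
  penalised-cong c≗c′ rewrite cost-cong G c≗c′ | together-cong c≗c′ = refl
  c₁ = proj₁ (argmin-→ ℤ.≤-totalOrder n id penalised penalised-cong)
  c₁-least : ∀ c → penalised c₁ ≤ penalised c
  c₁-least = proj₂ (argmin-→ ℤ.≤-totalOrder n id penalised penalised-cong)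
  penalised-optimal : ∀ {c} → cost G c ℕ.≤ cost G c₀ → penalised c ≡ together c
  penalised-optimal {c} c≤c₀ rewrite dec-true (cost G c ℕ.≤? cost G c₀) c≤c₀ = refl
  penalised-non-optimal : ∀ {c} → ¬ cost G c ℕ.≤ cost G c₀ → penalised c ≡ ℤ.suc (together c₀)
  penalised-non-optimal {c} c≰c₀ rewrite dec-false (cost G c ℕ.≤? cost G c₀) c≰c₀ = refl
  c₁≤c₀ : cost G c₁ ℕ.≤ cost G c₀
  c₁≤c₀ = decidable-stable (cost G c₁ ℕ.≤? cost G c₀) λ c₁≰c₀ →
    ℤ.<⇒≱ (ℤ.suc[i]≤j⇒i<j ℤ.≤-refl) (begin
      ℤ.suc (together c₀) ≡⟨ sym (penalised-non-optimal c₁≰c₀) ⟩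
      penalised c₁        ≤⟨ c₁-least c₀ ⟩
      penalised c₀        ≡⟨ penalised-optimal ℕ.≤-refl ⟩
      together c₀         ∎)
    where open ℤ.≤-Reasoning
  c₁-optimal : Optimal G c₁
  c₁-optimal c = ℕ.≤-trans c₁≤c₀ (c₀-optimal c)
  c₁-finest : IsFinest G c₁
  c₁-finest c c≤c₁ = begin
    together c₁  ≡⟨ sym (penalised-optimal c₁≤c₀) ⟩
    penalised c₁ ≤⟨ c₁-least c ⟩
    penalised c  ≡⟨ penalised-optimal (ℕ.≤-trans c≤c₁ c₁≤c₀) ⟩
    together c   ∎
    where open ℤ.≤-Reasoning

module Finest {n} {G : Graph n} {c : Clustering n} (c-optimal : Optimal G c) (c-finest : IsFinest G c) where
  open Relabelling G c

  module _ {P : Pred (Fin n) ℓ} (P? : Decidable P) {k l : Fin n} (P⊆k : P ⊆ cluster k) where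

    gain-nonneg : 0ℤ ≤ gain P? k l
    gain-nonneg = ℤ.≮⇒≥ λ gain<0 → ℤ.<⇒≱ (begin-strict
      + cost G (relabel P? l c) ≡⟨ cost-relabel P? l P⊆k ⟩
      + cost G c + gain P? k l  <⟨ ℤ.+-monoʳ-< (+ cost G c) gain<0 ⟩
      + cost G c + 0ℤ           ≡⟨ ℤ.+-identityʳ _ ⟩
      + cost G c                ∎) (ℤ.+≤+ (c-optimal (relabel P? l c)))
      where open ℤ.≤-Reasoning

    marginal-nonneg : ∀ {ρ τ} → SignsFactorise P k l ρ τ → 0ℤ < ∑⟨ P? ⟩ ρ →
                      0ℤ ≤ marginal P? k l τ
    marginal-nonneg fact 0<ρ = ℤ.≮⇒≥ λ marginal<0 →
      ℤ.<⇒≱ (pos*neg<0 0<ρ marginal<0) (subst (0ℤ ≤_) (gain-factorises P? fact) gain-nonneg)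

    no-neutral-split : ∀ {x y} → Empty (cluster l) → c x ≡ k → ¬ P x → P y → gain P? k l ≤ 0ℤ → ⊥
    no-neutral-split l-unused cx≡k ¬Px Py gain≤0 =
      ℤ.<⇒≱ (together-split P? P⊆k l-unused cx≡k ¬Px Py)
            (c-finest (relabel P? l c) (ℤ.drop‿+≤+ no-worse))
      where
      open ℤ.≤-Reasoning
      no-worse : + cost G (relabel P? l c) ≤ + cost G c
      no-worse = begin
        + cost G (relabel P? l c) ≡⟨ cost-relabel P? l P⊆k ⟩
        + cost G c + gain P? k l  ≤⟨ ℤ.+-monoʳ-≤ (+ cost G c) gain≤0 ⟩
        + cost G c + 0ℤ           ≡⟨ ℤ.+-identityʳ _ ⟩
        + cost G c                ∎

  -- Moving z alone into the cluster of z′, and z′ alone into that of z, have marginals summing to −2.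
  twins-together : ∀ {z z′} → z ≢ z′ → adj G z z′ ≡ true →
    (∀ w → w ≢ z → w ≢ z′ → adj G z w ≡ adj G z′ w) → c z ≡ c z′
  twins-together {z} {z′} z≢z′ zz′ twins with c z ≟ c z′
  ... | yes same  = same
  ... | no  apart = ⊥-elim (ℤ.<⇒≱ both-moves<0 (ℤ.+-mono-≤ (alone-nonneg z z′) (alone-nonneg z′ z)))
    where
    term : Fin n → Fin n → Fin n → ℤ
    term a b v = if does (∁? (_≟ a) v) then σ a v * δ (c a) (c b) v else 0ℤ
    alone-nonneg : ∀ a b → 0ℤ ≤ marginal (_≟ a) (c a) (c b) (σ a)
    alone-nonneg a b = marginal-nonneg (_≟ a) (λ { refl → refl }) (λ { refl _ _ → sym (ℤ.*-identityˡ _) })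
                                       (count-pos (_≟ a) refl)
    term-self : ∀ a b → term a b a ≡ 0ℤ
    term-self a b rewrite dec-true (a ≟ a) refl = refl
    term-partner : ∀ {a b} → b ≢ a → adj G a b ≡ true → c b ≢ c a → term a b b ≡ -1ℤ
    term-partner {a} {b} b≢a ab cb≢ca
      rewrite dec-false (b ≟ a) b≢a | ab | dec-false (c b ≟ c a) cb≢ca | dec-true (c b ≟ c b) refl = refl
    cancel : ∀ s x y → s * (x - y) + s * (y - x) ≡ 0ℤ
    cancel = solve-∀
    elsewhere : ∀ {v} → v ≢ z → v ≢ z′ → term z z′ v + term z′ z v ≡ 0ℤ
    elsewhere {v} v≢z v≢z′
      rewrite dec-false (v ≟ z) v≢z | dec-false (v ≟ z′) v≢z′ | twins v v≢z v≢z′ =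
      cancel (± (adj G z′ v)) (𝟙 (does (c v ≟ c z))) (𝟙 (does (c v ≟ c z′)))
    at-z : term z z′ z + term z′ z z < 0ℤ
    at-z rewrite term-self z z′ | term-partner z≢z′ (trans (adj-sym G z′ z) zz′) apart = ℤ.-<+
    at-z′ : term z z′ z′ + term z′ z z′ < 0ℤ
    at-z′ rewrite term-partner (z≢z′ ∘ sym) zz′ (apart ∘ sym) | term-self z′ z = ℤ.-<+
    both : ∀ v → Dec (v ≡ z) → Dec (v ≡ z′) → term z z′ v + term z′ z v ≤ 0ℤ
    both _ (yes refl) _          = ℤ.<⇒≤ at-z
    both _ (no _)     (yes refl) = ℤ.<⇒≤ at-z′
    both v (no v≢z)   (no v≢z′)  = ℤ.≤-reflexive (elsewhere v≢z v≢z′)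
    both-moves<0 : marginal (_≟ z) (c z) (c z′) (σ z) + marginal (_≟ z′) (c z′) (c z) (σ z′) < 0ℤ
    both-moves<0 = subst (_< 0ℤ) (∑-distrib-+ (term z z′) (term z′ z))
                         (∑-neg (λ v → both v (v ≟ z) (v ≟ z′)) z at-z)

-- Single growth of every clade

module SingleGrowth {n} {G : Graph n} {T : Tree n} (cot : IsCotree G T)
                    (one : OneNodesAtMostOneNonLeafChild T)
                    {c : Clustering n} (c-optimal : Optimal G c) (c-finest : IsFinest G c) where
  open Cotree {G = G} {T = T} cot
  open import Data.List.Membership.DecPropositional (_≟_ {n}) using (_∈?_)
  open Relabelling G c
  open Finest {G = G} {c = c} c-optimal c-finest

  In : Tree n → Pred (Fin n) _
  In t v = v ∈ leaves t

  split-under-0-node : ∀ {h hs V ka} → node false h hs ≼ T → V ∈ children (node false h hs) →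
    Grows c (leaves V) ka → cluster ka ⊆ In (node false h hs) → ⊥
  split-under-0-node {V = V} {ka} W≼T V∈ ((xa , cxa , xa∈V) , (ya , cya , ya∉V)) ka⊆W
    with unused-label c (λ { refl → ya∉V xa∈V }) (trans cxa (sym cya))
  ... | l , l-unused = ℤ.<⇒≱ marginal<0 (marginal-nonneg P? proj₁ factor (count-pos P? (cxa , xa∈V)))
    where
    P : Pred (Fin n) _
    P v = c v ≡ ka × v ∈ leaves V
    P? : Decidable P
    P? v = (c v ≟ ka) ×-dec (v ∈? leaves V)
    factor : SignsFactorise P ka l (λ _ → 1ℤ) (λ _ → -1ℤ)
    factor (_ , u∈V) ¬Pv (inj₁ cv≡ka) =
      cong ± (adj-across-child W≼T V∈ u∈V (ka⊆W cv≡ka) (λ v∈V → ¬Pv (cv≡ka , v∈V)))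
    factor _ _ (inj₂ cv≡l) = ⊥-elim (l-unused _ cv≡l)
    term≤0 : ∀ v → -1ℤ * δ ka l v ≤ 0ℤ
    term≤0 v = subst (λ x → -1ℤ * x ≤ 0ℤ) (sym (δ-unused l-unused v)) (-𝟙≤0 (does (c v ≟ ka)))
    term-ya<0 : -1ℤ * δ ka l ya < 0ℤ
    term-ya<0 = subst (λ x → -1ℤ * x < 0ℤ)
                      (sym (trans (δ-unused l-unused ya) (cong 𝟙 (dec-true (c ya ≟ ka) cya)))) ℤ.-<+
    marginal<0 : marginal P? ka l (λ _ → -1ℤ) < 0ℤ
    marginal<0 = ∑⟨⟩-neg (∁? P?) (λ {v} _ → term≤0 v) (λ { (_ , ya∈V) → ya∉V ya∈V }) term-ya<0

  module UnderOneNode {h hs V} (W≼T : node true h hs ≼ T) (V∈ : V ∈ children (node true h hs))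
                      (V-inner : ¬ IsLeaf V) {ka ya} (ka⊆W : cluster ka ⊆ In (node true h hs))
                      (cya : c ya ≡ ka) (ya∉V : ya ∉ leaves V) where

    W : Tree n
    W = node true h hs

    Rest : Pred (Fin n) _
    Rest v = v ∈ leaves W × v ∉ leaves V

    Rest? : Decidable Rest
    Rest? v = (v ∈? leaves W) ×-dec ¬? (v ∈? leaves V)

    ya∈W : ya ∈ leaves W
    ya∈W = ka⊆W cya

    rest-universal : ∀ {z w} → Rest z → w ∈ leaves W → w ≢ z → adj G z w ≡ true
    rest-universal (z∈W , z∉V) w∈W w≢z =
      adj-across-child W≼T (other-children-are-leaves one W≼T V∈ V-inner z∈W z∉V) (here refl) w∈W
                       (λ { (here w≡z) → w≢z w≡z })

    Rest⊆ka : Rest ⊆ cluster ka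
    Rest⊆ka {z} Rest-z@(z∈W , _) with z ≟ ya
    ... | yes refl = cya
    ... | no z≢ya  = trans (twins-together z≢ya (rest-universal Rest-z ya∈W (z≢ya ∘ sym)) twins) cya
      where
      twins : ∀ w → w ≢ z → w ≢ ya → adj G z w ≡ adj G ya w
      twins w w≢z w≢ya with w ∈? leaves W
      ... | yes w∈W = trans (rest-universal Rest-z w∈W w≢z) (sym (rest-universal (ya∈W , ya∉V) w∈W w≢ya))
      ... | no  w∉W = trans (adj-sym G z w) (trans (clade-module W≼T w∉W z∈W ya∈W) (adj-sym G w ya))

    σ-module : ∀ {x₀ u v} → x₀ ∈ leaves W → u ∉ leaves W → v ∈ leaves W → σ u v ≡ σ u x₀
    σ-module x₀∈W u∉W v∈W = cong ± (clade-module W≼T u∉W v∈W x₀∈W)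

    module _ {kb} (ka≢kb : ka ≢ kb) {xb yb} (cxb : c xb ≡ kb) (xb∈V : xb ∈ leaves V)
             (cyb : c yb ≡ kb) (yb∉V : yb ∉ leaves V) where

      Out : Pred (Fin n) _
      Out v = c v ≡ kb × v ∉ leaves V

      Out? : Decidable Out
      Out? v = (c v ≟ kb) ×-dec ¬? (v ∈? leaves V)

      Out-outside-W : ∀ {v} → Out v → v ∉ leaves W
      Out-outside-W (cv≡kb , v∉V) v∈W = ka≢kb (trans (sym (Rest⊆ka (v∈W , v∉V))) cv≡kb)

      xb∈W : xb ∈ leaves W
      xb∈W = leaves-child {t = W} V∈ xb∈V

      r : ℤ
      r = ∑⟨ Out? ⟩ λ u → σ u xb

      Out-factor : ∀ {l} → cluster l ⊆ In W → SignsFactorise Out kb l (λ u → σ u xb) (λ _ → 1ℤ)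
      Out-factor {l} l⊆W {v = v} Out-u ¬Out-v kb-or-l =
        trans (σ-module xb∈W (Out-outside-W Out-u) (in-W kb-or-l)) (sym (ℤ.*-identityʳ _))
        where
        in-W : c v ≡ kb ⊎ c v ≡ l → v ∈ leaves W
        in-W (inj₁ cv≡kb) =
          leaves-child {t = W} V∈ (decidable-stable (v ∈? leaves V) λ v∉V → ¬Out-v (cv≡kb , v∉V))
        in-W (inj₂ cv≡l)  = l⊆W cv≡l

      r≤0-impossible : r ≤ 0ℤ → ⊥
      r≤0-impossible r≤0 with unused-label c (λ { refl → yb∉V xb∈V }) (trans cxb (sym cyb))
      ... | l , l-unused =
        no-neutral-split Out? proj₁ l-unused cxb (λ Out-xb → proj₂ Out-xb xb∈V) (cyb , yb∉V) gain≤0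
        where
        term≥0 : ∀ v → 0ℤ ≤ 1ℤ * δ kb l v
        term≥0 v = subst (λ x → 0ℤ ≤ 1ℤ * x) (sym (δ-unused l-unused v))
                         (subst (0ℤ ≤_) (sym (ℤ.*-identityˡ _)) (0≤𝟙 (does (c v ≟ kb))))
        gain≤0 : gain Out? kb l ≤ 0ℤ
        gain≤0 = subst (_≤ 0ℤ) (sym (gain-factorises Out? (Out-factor λ {v} → ⊥-elim ∘ l-unused v)))
                       (nonpos*nonneg≤0 r≤0 (∑⟨⟩-nonneg (∁? Out?) λ {v} _ → term≥0 v))

      τ : Fin n → ℤ
      τ v = if does (v ∈? leaves V) then 1ℤ else σ v xb

      Rest-factor : SignsFactorise Rest ka kb (λ _ → 1ℤ) τ
      Rest-factor {u} {v} Rest-u ¬Rest-v ka-or-kb with v ∈? leaves V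
      ... | yes v∈V =
        cong ± (rest-universal Rest-u (leaves-child {t = W} V∈ v∈V) λ { refl → proj₂ Rest-u v∈V })
      ... | no  v∉V with ka-or-kb
      ...   | inj₁ cv≡ka = ⊥-elim (¬Rest-v (ka⊆W cv≡ka , v∉V))
      ...   | inj₂ cv≡kb = trans (cong ± (adj-sym G u v))
                                 (trans (σ-module xb∈W (Out-outside-W (cv≡kb , v∉V)) (proj₁ Rest-u))
                                        (sym (ℤ.*-identityˡ _)))

      -- The summand at v of  marginal Out? kb ka 1 + marginal Rest? ka kb τ + r,  as a function of the
      -- four decisions about v, so that it can be evaluated by cases: it is −1 on Rest and 0 elsewhere.
      summand : ∀ v → Dec (c v ≡ ka) → Dec (c v ≡ kb) → Dec (v ∈ leaves V) → Dec (v ∈ leaves W) →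
                ℤ
      summand v a b i w =
          (if not (does b ∧ not (does i)) then 1ℤ * (𝟙 (does b) - 𝟙 (does a)) else 0ℤ)
        + (if not (does w ∧ not (does i))
             then (if does i then 1ℤ else σ v xb) * (𝟙 (does a) - 𝟙 (does b)) else 0ℤ)
        + (if does b ∧ not (does i) then σ v xb else 0ℤ)

      summand≤0 : ∀ v a b i w → summand v a b i w ≤ 0ℤ
      summand≤0 v (yes ≡ka) (yes ≡kb) _          _          = ⊥-elim (ka≢kb (trans (sym ≡ka) ≡kb))
      summand≤0 v (yes _)   (no _)    (yes _)    (yes _)    = ℤ.≤-refl
      summand≤0 v (yes _)   (no _)    (yes _)    (no _)     = ℤ.≤-refl
      summand≤0 v (yes _)   (no _)    (no _)     (yes _)    = ℤ.-≤+
      summand≤0 v (yes ≡ka) (no _)    (no _)     (no v∉W)   = ⊥-elim (v∉W (ka⊆W ≡ka))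
      summand≤0 v (no _)    (yes _)   (yes _)    (yes _)    = ℤ.≤-refl
      summand≤0 v (no _)    (yes _)   (yes _)    (no _)     = ℤ.≤-refl
      summand≤0 v (no _)    (yes ≡kb) (no v∉V)   (yes v∈W)  = ⊥-elim (Out-outside-W (≡kb , v∉V) v∈W)
      summand≤0 v (no _)    (yes _)   (no _)     (no _)     = ℤ.≤-reflexive (cancel (σ v xb))
        where
        cancel : ∀ s → 0ℤ + s * -1ℤ + s ≡ 0ℤ
        cancel = solve-∀
      summand≤0 v (no _)    (no _)    (yes _)    (yes _)    = ℤ.≤-refl
      summand≤0 v (no _)    (no _)    (yes _)    (no _)     = ℤ.≤-refl
      summand≤0 v (no _)    (no _)    (no _)     (yes _)    = ℤ.≤-refl
      summand≤0 v (no _)    (no _)    (no _)     (no _)     = ℤ.≤-reflexive (vanish (σ v xb))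
        where
        vanish : ∀ s → 0ℤ + s * 0ℤ + 0ℤ ≡ 0ℤ
        vanish = solve-∀

      summand-ya<0 : summand ya (c ya ≟ ka) (c ya ≟ kb) (ya ∈? leaves V) (ya ∈? leaves W) < 0ℤ
      summand-ya<0 rewrite dec-true (c ya ≟ ka) cya | dec-false (c ya ≟ kb) (ka≢kb ∘ trans (sym cya))
                        | dec-false (ya ∈? leaves V) ya∉V | dec-true (ya ∈? leaves W) ya∈W = ℤ.-<+

      r>0-impossible : 0ℤ < r → ⊥
      r>0-impossible 0<r =
        ℤ.<⇒≱ total<0 (ℤ.+-mono-≤ (ℤ.+-mono-≤ Out-marginal≥0 Rest-marginal≥0) (ℤ.<⇒≤ 0<r))
        where
        Out-marginal≥0 : 0ℤ ≤ marginal Out? kb ka (λ _ → 1ℤ)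
        Out-marginal≥0 = marginal-nonneg Out? proj₁ (Out-factor ka⊆W) 0<r
        Rest-marginal≥0 : 0ℤ ≤ marginal Rest? ka kb τ
        Rest-marginal≥0 = marginal-nonneg Rest? Rest⊆ka Rest-factor (count-pos Rest? (ya∈W , ya∉V))
        t₁ t₂ t₃ : Fin n → ℤ
        t₁ v = if does (∁? Out? v) then 1ℤ * δ kb ka v else 0ℤ
        t₂ v = if does (∁? Rest? v) then τ v * δ ka kb v else 0ℤ
        t₃ v = if does (Out? v) then σ v xb else 0ℤ
        pointwise : ∀ v → t₁ v + t₂ v + t₃ v ≤ 0ℤ
        pointwise v = summand≤0 v (c v ≟ ka) (c v ≟ kb) (v ∈? leaves V) (v ∈? leaves W)
        total<0 : marginal Out? kb ka (λ _ → 1ℤ) + marginal Rest? ka kb τ + r < 0ℤ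
        total<0 = subst (_< 0ℤ) (trans (∑-distrib-+ (λ v → t₁ v + t₂ v) t₃)
                                       (cong (_+ r) (∑-distrib-+ t₁ t₂)))
                        (∑-neg {f = λ v → t₁ v + t₂ v + t₃ v} pointwise ya summand-ya<0)

      impossible : ⊥
      impossible with r ℤ.≤? 0ℤ
      ... | yes r≤0 = r≤0-impossible r≤0
      ... | no  r≰0 = r>0-impossible (ℤ.≰⇒> r≰0)

  leaf-grows-once : ∀ {v ka kb} → Grows c (leaves (leaf v)) ka → Grows c (leaves (leaf v)) kb → ka ≡ kb
  leaf-grows-once ((_ , cx≡ka , here refl) , _) ((_ , cx≡kb , here refl) , _) = trans (sym cx≡ka) cx≡kb

  no-double-growth : ∀ {W V ka kb} → W ≼ T → V ∈ children W → ka ≢ kb →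
    Grows c (leaves V) ka → Grows c (leaves V) kb → cluster ka ⊆ In W → ⊥
  no-double-growth {leaf _}          _   ()
  no-double-growth {node false _ _}  W≼T V∈ _ ka-grows _ ka⊆W = split-under-0-node W≼T V∈ ka-grows ka⊆W
  no-double-growth {node true _ _} {leaf _} _ _ ka≢kb ka-grows kb-grows _ =
    ka≢kb (leaf-grows-once ka-grows kb-grows)
  no-double-growth {node true _ _} {node _ _ _} W≼T V∈ ka≢kb
                   (_ , (ya , cya , ya∉V)) ((xb , cxb , xb∈V) , (yb , cyb , yb∉V)) ka⊆W =
    UnderOneNode.impossible W≼T V∈ (λ ()) ka⊆W cya ya∉V ka≢kb cxb xb∈V cyb yb∉V

  contained-or-grows : ∀ W {k x} → c x ≡ k → x ∈ leaves W → cluster k ⊆ In W ⊎ Grows c (leaves W) k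
  contained-or-grows W {k} {x} cx≡k x∈W with all? (λ v → (c v ≟ k) →-dec (v ∈? leaves W))
  ... | yes contained = inj₁ (λ {v} → contained v)
  ... | no ¬contained with ¬∀⟶∃¬ n _ (λ v → (c v ≟ k) →-dec (v ∈? leaves W)) ¬contained
  ...   | v , escapes with c v ≟ k
  ...     | yes cv≡k = inj₂ ((x , cx≡k , x∈W) , (v , cv≡k , λ v∈W → escapes λ _ → v∈W))
  ...     | no  cv≢k = ⊥-elim (escapes λ cv≡k → ⊥-elim (cv≢k cv≡k))

  single-growth-child : ∀ {W V} → W ≼ T → SingleGrowth c (leaves W) → V ∈ children W →
    SingleGrowth c (leaves V)
  single-growth-child {W} W≼T W-single V∈ ka kb
                      ka-grows@((xa , cxa , xa∈V) , _) kb-grows@((xb , cxb , xb∈V) , _)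
    with ka ≟ kb
  ... | yes ka≡kb = ka≡kb
  ... | no  ka≢kb with contained-or-grows W cxa (leaves-child {t = W} V∈ xa∈V)
                     | contained-or-grows W cxb (leaves-child {t = W} V∈ xb∈V)
  ...   | inj₁ ka⊆W    | _            = ⊥-elim (no-double-growth W≼T V∈ ka≢kb ka-grows kb-grows ka⊆W)
  ...   | inj₂ _       | inj₁ kb⊆W    =
    ⊥-elim (no-double-growth W≼T V∈ (ka≢kb ∘ sym) kb-grows ka-grows kb⊆W)
  ...   | inj₂ W-in-ka | inj₂ W-in-kb = W-single ka kb W-in-ka W-in-kb

  single-growth-below : ∀ {t s} → t ≼ T → SingleGrowth c (leaves t) → s ≼ t → SingleGrowth c (leaves s)
  single-growth-below t≼T t-single ≼-refl           = t-single
  single-growth-below t≼T t-single (≼-child d∈ s≼d) =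
    single-growth-below (≼-trans (≼-child d∈ ≼-refl) t≼T) (single-growth-child t≼T t-single d∈) s≼d

  every-clade-single-growth : ∀ s → s ≼ T → SingleGrowth c (leaves s)
  every-clade-single-growth s = single-growth-below ≼-refl root-single-growth
    where
    root-single-growth : SingleGrowth c (leaves T)
    root-single-growth _ _ (_ , (v , _ , v∉T)) _ = ⊥-elim (v∉T (every-vertex-leaf v))

lemma3 : ∀ {n : ℕ} (G : Graph n) (T : Tree n) →
    IsCotree G T → OneNodesAtMostOneNonLeafChild T →
    ∃[ c ] (Optimal G c × (∀ s → s ≼ T → SingleGrowth c (leaves s)))
lemma3 G T cot one = single-growth (optimal-finest-clustering G)
  where
  single-growth : ∃[ c ] Optimal G c × IsFinest G c →
                  ∃[ c ] (Optimal G c × (∀ s → s ≼ T → SingleGrowth c (leaves s)))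
  single-growth (c , c-optimal , c-finest) =
    c , c-optimal , SingleGrowth.every-clade-single-growth {G = G} {T = T} cot one {c} c-optimal c-finest
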